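{- For all integers $t,s\ge 2$, $R^3(HK_t,HK_s)\le 2st(s+t)$.
   Context: For a graph $G=(V,E)$, its 3-expansion $HG$ is the 3-uniform hypergraph obtained by adding to each edge $e\in E$ a new vertex $u_e$, distinct for distinct edges; i.e. $V(HG)=V\cup\{u_e:e\in E\}$ and $E(HG)=\{e\cup\{u_e\}: e\in E\}$. $K_n$ is the complete graph on $n$ vertices. For 3-uniform hypergraphs $\mathcal{F}_1,\mathcal{F}_2$, $R^3(\mathcal{F}_1,\mathcal{F}_2)$ is the least $N$ such that every 2-coloring of the hyperedges of the complete 3-uniform hypergraph on $N$ vertices contains a subhypergraph of the first color isomorphic to $\mathcal{F}_1$ or one of the second color isomorphic to $\mathcal{F}_2$. -}

module Defs where

open import Data.Nat using (ℕ)
open import Data.Fin using (Fin; _<_)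
open import Data.Bool using (Bool)
open import Data.Product using (Σ; _×_)
open import Relation.Binary.PropositionalEquality using (_≡_; _≢_)

-- A 2-colouring of the hyperedges (3-element subsets) of the complete
-- 3-uniform hypergraph on vertex set Fin N, represented as a function on
-- triples that is invariant under permutation of its arguments (values on
-- triples with repeated entries are irrelevant).  Colour `true` is the
-- first colour, `false` the second.
record Colouring (N : ℕ) : Set where
  field
    col    : Fin N → Fin N → Fin N → Bool
    sym₁₂  : ∀ a b c → col a b c ≡ col b a c
    sym₂₃  : ∀ a b c → col a b c ≡ col a c b
open Colouring public

-- A copy of the 3-expansion HK_t of K_t, all of whose hyperedges have
-- colour χ under colouring C: an injective embedding of the vertex set
-- of HK_t, i.e. core vertices φ i (i : Fin t) and, for each pair i < j,
-- an extra vertex u i j (only the values with i < j are used), all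
-- pairwise distinct, such that each hyperedge {φ i, φ j, u i j} has colour χ.
record MonoHK {N : ℕ} (C : Colouring N) (χ : Bool) (t : ℕ) : Set where
  field
    φ      : Fin t → Fin N
    u      : Fin t → Fin t → Fin N
    φ-inj  : ∀ i j → φ i ≡ φ j → i ≡ j
    u-inj  : ∀ i j k l → i < j → k < l → u i j ≡ u k l → (i ≡ k) × (j ≡ l)
    u≢φ    : ∀ i j k → i < j → u i j ≢ φ k
    colour : ∀ i j → i < j → col C (φ i) (φ j) (u i j) ≡ χ

-- Put A = t² + t and B = s² + s, and call a pair xy red-poor (blue-poor) if at most A (B)
-- vertices z make xyz red (blue). Fix x and count the pairs (y, z) with xy red-poor and xz
-- blue-poor: each is charged to the red codegree of xy or to the blue codegree of xz, so
-- d e ≤ d A + e B, where d and e count red-poor and blue-poor partners of x. Hence x has at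
-- most 2B red-poor or at most 2A blue-poor partners, so more than (t − 1)(2B + 1) vertices have
-- few red-poor partners or more than (s − 1)(2A + 1) have few blue-poor ones. A greedy choice
-- among them yields t (resp. s) vertices spanning no poor pair, and since every codegree among
-- them exceeds the number of vertices chosen in total, the expansion vertices are chosen greedily too.

module Submission where

open import Defs
open import Data.Nat using (ℕ; zero; suc; _+_; _*_; _≤_; _<_; z≤n; s≤s; s≤s⁻¹; s<s⁻¹; _≤ᵇ_; _≤?_; _<?_; z<s)
open import Data.Nat.Properties hiding (_≟_)
open import Data.Fin using (Fin; zero; suc; combine; remQuot) renaming (_<_ to _<ᶠ_)
open import Data.Fin.Properties using (_≟_; any?; combine-injective; remQuot-combine) renaming (_<?_ to _<?ᶠ_)
open import Data.Bool using (Bool; true; false; not; _∧_; _∨_; T; if_then_else_)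
open import Data.Bool.Properties using (T?; T-∨; T-not-≡) renaming (_≟_ to _≟ᵇ_)
open import Data.Sum using (_⊎_; inj₁; inj₂)
open import Function.Bundles using (Equivalence)
open import Data.Empty using (⊥-elim)
open import Data.Product using (Σ; ∃; _×_; _,_; proj₁; proj₂)
open import Data.Unit using (tt)
open import Data.Nat.Tactic.RingSolver using (solve-∀)
open import Function using (_∘_; Injective)
open import Relation.Nullary using (¬_; Dec; yes; no; contradiction)
open import Relation.Nullary.Decidable using (⌊_⌋; ⌊⌋-map′; fromWitness; toWitness)
open import Relation.Binary.PropositionalEquality
open import Data.Vec.Functional using (_∷_)
open import Algebra.Properties.Semiring.Sum +-*-semiring

infixl 6 _∪_ _─_

_∪_ _─_ : ∀ {n} → (Fin n → Bool) → (Fin n → Bool) → Fin n → Bool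
(p ∪ q) i = p i ∨ q i
(p ─ q) i = p i ∧ not (q i)

⁅_⁆ : ∀ {n} → Fin n → Fin n → Bool
⁅ x ⁆ i = ⌊ i ≟ x ⌋

∈-─ : ∀ {n} {p q : Fin n → Bool} {i} → T ((p ─ q) i) → T (p i) × ¬ T (q i)
∈-─ {p = p} {q} {i} i∈p─q with p i | q i
... | true | false = tt , λ ()

∉⁅⁆ : ∀ {n} {x i : Fin n} → ¬ T (⁅ x ⁆ i) → x ≢ i
∉⁅⁆ i∉⁅x⁆ = i∉⁅x⁆ ∘ fromWitness ∘ sym

∉-∪ : ∀ {n} {p q : Fin n → Bool} {i} → ¬ T ((p ∪ q) i) → ¬ T (p i) × ¬ T (q i)
∉-∪ i∉p∪q = i∉p∪q ∘ Equivalence.from T-∨ ∘ inj₁ , i∉p∪q ∘ Equivalence.from T-∨ ∘ inj₂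

𝟙 : Bool → ℕ
𝟙 true  = 1
𝟙 false = 0

count : ∀ {n} → (Fin n → Bool) → ℕ
count {n} p = ∑[ i < n ] 𝟙 (p i)

∑-mono-≤ : ∀ {n} {f g : Fin n → ℕ} → (∀ i → f i ≤ g i) → sum f ≤ sum g
∑-mono-≤ {zero}  f≤g = z≤n
∑-mono-≤ {suc n} f≤g = +-mono-≤ (f≤g zero) (∑-mono-≤ (f≤g ∘ suc))

count-true : ∀ {n} → count {n} (λ _ → true) ≡ n
count-true {zero}  = refl
count-true {suc n} = cong suc count-true

count-⁅⁆ : ∀ {n} (x : Fin n) → count ⁅ x ⁆ ≡ 1
count-⁅⁆ {suc n} zero    = cong suc (sum-replicate-zero n)
count-⁅⁆ {suc n} (suc x) = trans (sum-cong-≗ (λ i → cong 𝟙 (⌊⌋-map′ _ _ (i ≟ x)))) (count-⁅⁆ x)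

module _ {n : ℕ} where

  count-mono : {p q : Fin n → Bool} → (∀ i → T (p i) → T (q i)) → count p ≤ count q
  count-mono p⊆q = ∑-mono-≤ (λ i → 𝟙-mono (p⊆q i))
    where
    𝟙-mono : ∀ {a b} → (T a → T b) → 𝟙 a ≤ 𝟙 b
    𝟙-mono {false}         _   = z≤n
    𝟙-mono {true} {true}   _   = ≤-refl
    𝟙-mono {true} {false}  a⇒b = ⊥-elim (a⇒b tt)

  count-∪ : (p q : Fin n → Bool) → count (p ∪ q) ≤ count p + count q
  count-∪ p q = ≤-trans (∑-mono-≤ (λ i → 𝟙-∨ (p i) (q i))) (≤-reflexive (∑-distrib-+ (𝟙 ∘ p) (𝟙 ∘ q)))
    where
    𝟙-∨ : ∀ a b → 𝟙 (a ∨ b) ≤ 𝟙 a + 𝟙 b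
    𝟙-∨ true  _ = s≤s z≤n
    𝟙-∨ false _ = ≤-refl

  count-─ : (p q : Fin n → Bool) → count p ≤ count (p ─ q) + count q
  count-─ p q = ≤-trans (count-mono (λ i → ⊆─∪ (p i) (q i))) (count-∪ (p ─ q) q)
    where
    ⊆─∪ : ∀ a b → T a → T ((a ∧ not b) ∨ b)
    ⊆─∪ true true  _ = tt
    ⊆─∪ true false _ = tt

  count-not : (p : Fin n → Bool) → count p + count (not ∘ p) ≡ n
  count-not p = begin
    count p + count (not ∘ p)             ≡⟨ ∑-distrib-+ (𝟙 ∘ p) (𝟙 ∘ not ∘ p) ⟨
    ∑[ i < n ] (𝟙 (p i) + 𝟙 (not (p i)))  ≡⟨ sum-cong-≗ (λ i → 𝟙+𝟙∘not (p i)) ⟩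
    count {n} (λ _ → true)                ≡⟨ count-true ⟩
    n                                     ∎
    where
    open ≡-Reasoning
    𝟙+𝟙∘not : ∀ a → 𝟙 a + 𝟙 (not a) ≡ 1
    𝟙+𝟙∘not true  = refl
    𝟙+𝟙∘not false = refl

  count-pos : (p : Fin n → Bool) → 0 < count p → ∃ λ i → T (p i)
  count-pos p 0<count with any? (T? ∘ p)
  ... | yes ∃p = ∃p
  ... | no  ∄p = contradiction count≡0 (>⇒≢ 0<count)
    where
    𝟙-false : ∀ {a} → ¬ T a → 𝟙 a ≡ 0
    𝟙-false {false} _  = refl
    𝟙-false {true}  ¬a = contradiction tt ¬a
    count≡0 : count p ≡ 0
    count≡0 = trans (sum-cong-≗ (λ i → 𝟙-false (λ pi → ∄p (i , pi)))) (sum-replicate-zero n)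

  count-─⁅⁆ : (p : Fin n → Bool) (x : Fin n) → count p ≤ suc (count (p ─ ⁅ x ⁆))
  count-─⁅⁆ p x = begin
    count p                         ≤⟨ count-─ p ⁅ x ⁆ ⟩
    count (p ─ ⁅ x ⁆) + count ⁅ x ⁆ ≡⟨ cong (count (p ─ ⁅ x ⁆) +_) (count-⁅⁆ x) ⟩
    count (p ─ ⁅ x ⁆) + 1           ≡⟨ +-comm (count (p ─ ⁅ x ⁆)) 1 ⟩
    suc (count (p ─ ⁅ x ⁆))         ∎
    where open ≤-Reasoning

  count-─∪⁅⁆ : (p q : Fin n → Bool) (x : Fin n) → count p ≤ suc (count q) + count (p ─ (q ∪ ⁅ x ⁆))
  count-─∪⁅⁆ p q x = begin
    count p                      ≤⟨ count-─ p (q ∪ ⁅ x ⁆) ⟩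
    rest + count (q ∪ ⁅ x ⁆)       ≤⟨ +-monoʳ-≤ rest (count-∪ q ⁅ x ⁆) ⟩
    rest + (count q + count ⁅ x ⁆) ≡⟨ cong (λ c → rest + (count q + c)) (count-⁅⁆ x) ⟩
    rest + (count q + 1)           ≡⟨ +-comm rest (count q + 1) ⟩
    count q + 1 + rest             ≡⟨ cong (_+ rest) (+-comm (count q) 1) ⟩
    suc (count q) + rest           ∎
    where
    open ≤-Reasoning
    rest = count (p ─ (q ∪ ⁅ x ⁆))

avoid : ∀ {n r} (p : Fin n → Bool) (forbidden : Fin r → Fin n) → r < count p →
  ∃ λ z → T (p z) × (∀ i → forbidden i ≢ z)
avoid {r = zero}  p forbidden 0<count with z , pz ← count-pos p 0<count = z , pz , λ ()
avoid {r = suc r} p forbidden r<count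
  with z , z∈p─f₀ , z∉ ← avoid (p ─ ⁅ forbidden zero ⁆) (forbidden ∘ suc)
                             (s≤s⁻¹ (<-≤-trans r<count (count-─⁅⁆ p (forbidden zero))))
  with z∈p , z≢f₀ ← ∈-─ {p = p} {⁅ forbidden zero ⁆} z∈p─f₀
  = z , z∈p , λ { zero → ∉⁅⁆ z≢f₀ ; (suc i) → z∉ i }

pickDistinct : ∀ {m n r} (P : Fin m → Fin n → Bool) (forbidden : Fin r → Fin n) →
  (∀ j → m + r ≤ count (P j)) →
  Σ (Fin m → Fin n) λ f →
    (∀ j → T (P j (f j))) × (∀ j i → forbidden i ≢ f j) × Injective _≡_ _≡_ f
pickDistinct {zero}  P forbidden _ = (λ ()) , (λ ()) , (λ ()) , λ { {()} }
pickDistinct {suc m} {r = r} P forbidden large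
  with z , z∈P₀ , z∉ ← avoid (P zero) forbidden (≤-trans (s≤s (m≤n+m r m)) (large zero))
  with g , g∈P , g∉ , g-inj ← pickDistinct (P ∘ suc) (z ∷ forbidden)
                                (λ j → ≤-trans (≤-reflexive (+-suc m r)) (large (suc j)))
  = z ∷ g , ∈P , ∉ , inj
  where
  ∈P : ∀ j → T (P j ((z ∷ g) j))
  ∈P zero    = z∈P₀
  ∈P (suc j) = g∈P j
  ∉ : ∀ j i → forbidden i ≢ (z ∷ g) j
  ∉ zero    = z∉
  ∉ (suc j) = g∉ j ∘ suc
  inj : Injective _≡_ _≡_ (z ∷ g)
  inj {zero}  {zero}  _   = refl
  inj {zero}  {suc j} z≡g = contradiction z≡g (g∉ j zero)
  inj {suc i} {zero}  g≡z = contradiction (sym g≡z) (g∉ i zero)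
  inj {suc i} {suc j} g≡g = cong suc (g-inj g≡g)

greedyIndependent : ∀ {n} (D : Fin n → Fin n → Bool) (p : Fin n → Bool) (c k : ℕ) →
  (∀ x → T (p x) → count (D x) ≤ c) → k * suc c < count p →
  Σ (Fin (suc k) → Fin n) λ φ →
    (∀ i → T (p (φ i))) × Injective _≡_ _≡_ φ × (∀ {i j} → i <ᶠ j → ¬ T (D (φ i) (φ j)))
greedyIndependent D p c zero sparse large with x , x∈p ← count-pos p large
  = (λ _ → x) , (λ _ → x∈p) , (λ { {zero} {zero} _ → refl }) , λ { {zero} {zero} () }
greedyIndependent D p c (suc k) sparse large
  with x , x∈p ← count-pos p (≤-<-trans z≤n large)
  with ψ , ψ∈p′ , ψ-inj , ψ-indep ← greedyIndependent D (p ─ (D x ∪ ⁅ x ⁆)) c k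
         (λ y y∈p′ → sparse y (proj₁ (∈-─ {p = p} {D x ∪ ⁅ x ⁆} y∈p′)))
         (+-cancelˡ-< (suc c) _ _ (<-≤-trans large
           (≤-trans (count-─∪⁅⁆ p (D x) x) (+-monoˡ-≤ _ (s≤s (sparse x x∈p))))))
  = x ∷ ψ , ∈p , inj , indep
  where
  ∈p : ∀ i → T (p ((x ∷ ψ) i))
  ∈p zero    = x∈p
  ∈p (suc i) = proj₁ (∈-─ {p = p} {D x ∪ ⁅ x ⁆} (ψ∈p′ i))
  excluded : ∀ i → ¬ T (D x (ψ i)) × ¬ T (⁅ x ⁆ (ψ i))
  excluded i = ∉-∪ {p = D x} {⁅ x ⁆} (proj₂ (∈-─ {p = p} {D x ∪ ⁅ x ⁆} (ψ∈p′ i)))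
  inj : Injective _≡_ _≡_ (x ∷ ψ)
  inj {zero}  {zero}  _   = refl
  inj {zero}  {suc j} x≡ψ = contradiction x≡ψ (∉⁅⁆ (proj₂ (excluded j)))
  inj {suc i} {zero}  ψ≡x = contradiction (sym ψ≡x) (∉⁅⁆ (proj₂ (excluded i)))
  inj {suc i} {suc j} ψ≡ψ = cong suc (ψ-inj ψ≡ψ)
  indep : ∀ {i j} → i <ᶠ j → ¬ T (D ((x ∷ ψ) i) ((x ∷ ψ) j))
  indep {zero}  {suc j} _   = proj₁ (excluded j)
  indep {suc i} {suc j} i<j = ψ-indep (s<s⁻¹ i<j)

degree : ∀ {n} → (Fin n → Fin n → Bool) → Bool → Fin n → ℕ
degree c χ y = count (λ z → ⌊ c y z ≟ᵇ χ ⌋)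

∑-𝟙*-≤ : ∀ {n} (p : Fin n → Bool) (f : Fin n → ℕ) (a : ℕ) → (∀ i → T (p i) → f i ≤ a) →
  ∑[ i < n ] (𝟙 (p i) * f i) ≤ count p * a
∑-𝟙*-≤ p f a bounded =
  ≤-trans (∑-mono-≤ (λ i → 𝟙*-mono (p i) (bounded i))) (≤-reflexive (sym (*-distribʳ-sum a (𝟙 ∘ p))))
  where
  𝟙*-mono : ∀ b {x} → (T b → x ≤ a) → 𝟙 b * x ≤ 𝟙 b * a
  𝟙*-mono true  x≤a = *-monoʳ-≤ 1 (x≤a tt)
  𝟙*-mono false _   = z≤n

product-dominates : ∀ d e A B → 2 * B < d → 2 * A < e → d * A + e * B < d * e
product-dominates d@(suc _) e A B d>2B e>2A = *-cancelˡ-< 2 _ _ (begin-strict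
  2 * (d * A + e * B)       ≡⟨ double d A e B ⟩
  d * (2 * A) + e * (2 * B) <⟨ +-mono-<-≤ (*-monoʳ-< d e>2A) (*-monoʳ-≤ e (<⇒≤ d>2B)) ⟩
  d * e + e * d             ≡⟨ cong (d * e +_) (*-comm e d) ⟩
  d * e + d * e             ≡⟨ cong (d * e +_) (+-identityʳ (d * e)) ⟨
  2 * (d * e)               ∎)
  where
  open ≤-Reasoning
  double : ∀ x y z w → 2 * (x * y + z * w) ≡ x * (2 * y) + z * (2 * w)
  double = solve-∀

module _ {n} (c : Fin n → Fin n → Bool) (c-sym : ∀ y z → c y z ≡ c z y) where

  -- A pair (y, z) ∈ P × Q is counted by the red degree of y or by the blue degree of z.
  count*count≤∑degree : (P Q : Fin n → Bool) →
    count P * count Q ≤ ∑[ y < n ] (𝟙 (P y) * degree c true y) + ∑[ z < n ] (𝟙 (Q z) * degree c false z)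
  count*count≤∑degree P Q = begin
    count P * count Q
      ≡⟨ *-distribʳ-sum (count Q) (𝟙 ∘ P) ⟩
    ∑[ y < n ] (𝟙 (P y) * count Q)
      ≡⟨ sum-cong-≗ (λ y → *-distribˡ-sum (𝟙 (P y)) (𝟙 ∘ Q)) ⟩
    ∑[ y < n ] ∑[ z < n ] (𝟙 (P y) * 𝟙 (Q z))
      ≤⟨ ∑-mono-≤ (λ y → ∑-mono-≤ (λ z → split (P y) (Q z) (c y z))) ⟩
    ∑[ y < n ] ∑[ z < n ] (red y z + blue y z)
      ≡⟨ sum-cong-≗ (λ y → ∑-distrib-+ (red y) (blue y)) ⟩
    ∑[ y < n ] (sum (red y) + ∑[ z < n ] blue y z)
      ≡⟨ ∑-distrib-+ (sum ∘ red) (λ y → ∑[ z < n ] blue y z) ⟩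
    ∑[ y < n ] sum (red y) + ∑[ y < n ] ∑[ z < n ] blue y z
      ≡⟨ cong (∑[ y < n ] sum (red y) +_) (∑-comm blue) ⟩
    ∑[ y < n ] sum (red y) + ∑[ z < n ] ∑[ y < n ] blue y z
      ≡⟨ cong₂ _+_ (sum-cong-≗ red-sum) (sum-cong-≗ blue-sum) ⟩
    ∑[ y < n ] (𝟙 (P y) * degree c true y) + ∑[ z < n ] (𝟙 (Q z) * degree c false z) ∎
    where
    open ≤-Reasoning
    red blue : Fin n → Fin n → ℕ
    red  y z = 𝟙 (P y) * 𝟙 ⌊ c y z ≟ᵇ true ⌋
    blue y z = 𝟙 (Q z) * 𝟙 ⌊ c y z ≟ᵇ false ⌋
    split : ∀ a b χ → 𝟙 a * 𝟙 b ≤ 𝟙 a * 𝟙 ⌊ χ ≟ᵇ true ⌋ + 𝟙 b * 𝟙 ⌊ χ ≟ᵇ false ⌋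
    split true  true  true  = s≤s z≤n
    split true  true  false = s≤s z≤n
    split false _     _     = z≤n
    split true  false _     = z≤n
    red-sum : ∀ y → sum (red y) ≡ 𝟙 (P y) * degree c true y
    red-sum y = sym (*-distribˡ-sum (𝟙 (P y)) (λ z → 𝟙 ⌊ c y z ≟ᵇ true ⌋))
    blue-sum : ∀ z → ∑[ y < n ] blue y z ≡ 𝟙 (Q z) * degree c false z
    blue-sum z = begin-equality
      ∑[ y < n ] blue y z
        ≡⟨ sum-cong-≗ (λ y → cong (λ b → 𝟙 (Q z) * 𝟙 ⌊ b ≟ᵇ false ⌋) (c-sym y z)) ⟩
      ∑[ y < n ] (𝟙 (Q z) * 𝟙 ⌊ c z y ≟ᵇ false ⌋)
        ≡⟨ *-distribˡ-sum (𝟙 (Q z)) (λ y → 𝟙 ⌊ c z y ≟ᵇ false ⌋) ⟨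
      𝟙 (Q z) * degree c false z ∎

  lowDegree-double-count : (A B : ℕ) →
    let d = count (λ y → degree c true y ≤ᵇ A); e = count (λ z → degree c false z ≤ᵇ B)
    in d * e ≤ d * A + e * B
  lowDegree-double-count A B = ≤-trans (count*count≤∑degree _ _)
    (+-mono-≤ (∑-𝟙*-≤ _ (degree c true) A (λ y → ≤ᵇ⇒≤ _ A)) (∑-𝟙*-≤ _ (degree c false) B (λ z → ≤ᵇ⇒≤ _ B)))

  lowDegree-dichotomy : (A B : ℕ) →
    count (λ y → degree c true y ≤ᵇ A) ≤ 2 * B ⊎ count (λ z → degree c false z ≤ᵇ B) ≤ 2 * A
  lowDegree-dichotomy A B
    with count (λ y → degree c true y ≤ᵇ A) ≤? 2 * B | count (λ z → degree c false z ≤ᵇ B) ≤? 2 * A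
  ... | yes d≤2B | _        = inj₁ d≤2B
  ... | no  _    | yes e≤2A = inj₂ e≤2A
  ... | no  d≰2B | no  e≰2A =
    contradiction (lowDegree-double-count A B) (<⇒≱ (product-dominates _ _ A B (≰⇒> d≰2B) (≰⇒> e≰2A)))

codegree : ∀ {N} → Colouring N → Bool → Fin N → Fin N → ℕ
codegree C χ x = degree (col C x) χ

monoHK-from-core : ∀ {N} (C : Colouring N) (χ : Bool) (k : ℕ) (φ : Fin k → Fin N) →
  Injective _≡_ _≡_ φ →
  (∀ {i j} → i <ᶠ j → k * k + k ≤ codegree C χ (φ i) (φ j)) → k * k + k ≤ N → MonoHK C χ k
monoHK-from-core {N} C χ k φ φ-inj rich large =
  let f , f∈P , f∉φ , f-inj = pickDistinct (colourable ∘ remQuot k) φ (colourable-large ∘ remQuot k)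
  in record
    { φ      = φ
    ; u      = λ i j → f (combine i j)
    ; φ-inj  = λ _ _ → φ-inj
    ; u-inj  = λ i j i′ j′ _ _ → combine-injective i j i′ j′ ∘ f-inj
    ; u≢φ    = λ i j l _ → ≢-sym (f∉φ (combine i j) l)
    ; colour = λ i j i<j → colourable-sound i<j
                 (subst (λ ij → T (colourable ij (f (combine i j)))) (remQuot-combine i j) (f∈P (combine i j)))
    }
  where
  -- Expansion vertices are also picked for the unused index pairs i ≥ j, hence k * k + k ≤ N.
  colourable : Fin k × Fin k → Fin N → Bool
  colourable (i , j) z = if ⌊ i <?ᶠ j ⌋ then ⌊ col C (φ i) (φ j) z ≟ᵇ χ ⌋ else true
  colourable-large : ∀ ij → k * k + k ≤ count (colourable ij)
  colourable-large (i , j) with i <?ᶠ j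
  ... | yes i<j = rich i<j
  ... | no  _   = subst (k * k + k ≤_) (sym count-true) large
  colourable-sound : ∀ {i j z} → i <ᶠ j → T (colourable (i , j) z) → col C (φ i) (φ j) z ≡ χ
  colourable-sound {i} {j} i<j coloured with i <?ᶠ j
  ... | yes _   = toWitness coloured
  ... | no  i≮j = contradiction i<j i≮j

poor : ∀ {N} → Colouring N → Bool → ℕ → Fin N → Fin N → Bool
poor C χ a x y = codegree C χ x y ≤ᵇ a

monoHK-from-fewPoorPairs : ∀ {N} (C : Colouring N) (χ : Bool) (k c : ℕ) (p : Fin N → Bool) →
  let a = suc k * suc k + suc k in
  (∀ x → T (p x) → count (poor C χ a x) ≤ c) → k * suc c < count p → a ≤ N → MonoHK C χ (suc k)
monoHK-from-fewPoorPairs C χ k c p fewPoor many a≤N =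
  let φ , _ , φ-inj , notPoor = greedyIndependent (poor C χ (suc k * suc k + suc k)) p c k fewPoor many
  in monoHK-from-core C χ (suc k) φ φ-inj (λ i<j → <⇒≤ (≰⇒> (notPoor i<j ∘ ≤⇒≤ᵇ))) a≤N

monochromaticHK : ∀ {N} (C : Colouring N) (k l : ℕ) →
  let A = suc k * suc k + suc k; B = suc l * suc l + suc l in
  A ≤ N → B ≤ N → k * suc (2 * B) + l * suc (2 * A) < N → MonoHK C true (suc k) ⊎ MonoHK C false (suc l)
monochromaticHK {N} C k l A≤N B≤N N-large = decide (k * suc (2 * B) <? count fewRedPoor)
  where
  A = suc k * suc k + suc k
  B = suc l * suc l + suc l
  fewRedPoor : Fin N → Bool
  fewRedPoor x = count (poor C true A x) ≤ᵇ 2 * B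
  fewBluePoor : ∀ x → T (not (fewRedPoor x)) → count (poor C false B x) ≤ 2 * A
  fewBluePoor x manyRedPoor with lowDegree-dichotomy (col C x) (sym₂₃ C x) A B
  ... | inj₁ fewRed  = ⊥-elim (subst T (Equivalence.to T-not-≡ manyRedPoor) (≤⇒≤ᵇ fewRed))
  ... | inj₂ fewBlue = fewBlue
  decide : Dec (k * suc (2 * B) < count fewRedPoor) → MonoHK C true (suc k) ⊎ MonoHK C false (suc l)
  decide (yes many) = inj₁ (monoHK-from-fewPoorPairs C true k (2 * B) fewRedPoor (λ x → ≤ᵇ⇒≤ _ _) many A≤N)
  decide (no  few)  = inj₂ (monoHK-from-fewPoorPairs C false l (2 * A) (not ∘ fewRedPoor) fewBluePoor
    (+-cancelˡ-< (k * suc (2 * B)) _ _ (<-≤-trans N-large (begin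
      N                                              ≡⟨ count-not fewRedPoor ⟨
      count fewRedPoor + count (not ∘ fewRedPoor)    ≤⟨ +-monoˡ-≤ _ (≮⇒≥ few) ⟩
      k * suc (2 * B) + count (not ∘ fewRedPoor)     ∎))) B≤N)
    where open ≤-Reasoning

square+≤ : ∀ l t → let s = suc l in t * t + t ≤ 2 * s * t * (s + t)
square+≤ l t = begin
  t * t + t              ≡⟨ +-comm (t * t) t ⟩
  t + t * t              ≡⟨ *-suc t t ⟨
  t * suc t              ≤⟨ *-monoʳ-≤ t (s≤s (m≤n+m t l)) ⟩
  t * (s + t)            ≤⟨ m≤n*m (t * (s + t)) (2 * s) ⟩
  2 * s * (t * (s + t))  ≡⟨ *-assoc (2 * s) t (s + t) ⟨
  2 * s * t * (s + t)    ∎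
  where
  open ≤-Reasoning
  s = suc l

2mn≤m²+n² : ∀ m n → 2 * m * n ≤ m * m + n * n
2mn≤m²+n² m n with ≤-total m n
... | inj₁ m≤n with o , refl ← m≤n⇒∃[o]m+o≡n m≤n =
  ≤-trans (m≤m+n _ (o * o)) (≤-reflexive (square-gap m o))
  where
  square-gap : ∀ m o → 2 * m * (m + o) + o * o ≡ m * m + (m + o) * (m + o)
  square-gap = solve-∀
... | inj₂ n≤m with o , refl ← m≤n⇒∃[o]m+o≡n n≤m =
  ≤-trans (m≤m+n _ (o * o)) (≤-reflexive (square-gap n o))
  where
  square-gap : ∀ n o → 2 * (n + o) * n + o * o ≡ (n + o) * (n + o) + n * n
  square-gap = solve-∀

-- The slack is 2 (s − t)² + s + t + 2, rearranged to avoid truncated subtraction.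
core-bound : ∀ k l → let t = suc k; s = suc l in
  k * suc (2 * (s * s + s)) + l * suc (2 * (t * t + t)) < 2 * s * t * (s + t)
core-bound k l = +-cancelʳ-≤ (2 * (s * s + t * t)) _ _ (begin
  suc X + 2 * (s * s + t * t)              ≤⟨ +-monoˡ-≤ _ (m<m+n X z<s) ⟩
  X + (s + t + 2) + 2 * (s * s + t * t)    ≡⟨ identity k l ⟩
  2 * s * t * (s + t) + 2 * (2 * s * t)    ≤⟨ +-monoʳ-≤ (2 * s * t * (s + t)) (*-monoʳ-≤ 2 (2mn≤m²+n² s t)) ⟩
  2 * s * t * (s + t) + 2 * (s * s + t * t) ∎)
  where
  open ≤-Reasoning
  t = suc k
  s = suc l
  X = k * suc (2 * (s * s + s)) + l * suc (2 * (t * t + t))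
  identity : ∀ k l →
    k * suc (2 * (suc l * suc l + suc l)) + l * suc (2 * (suc k * suc k + suc k))
      + (suc l + suc k + 2) + 2 * (suc l * suc l + suc k * suc k)
    ≡ 2 * suc l * suc k * (suc l + suc k) + 2 * (2 * suc l * suc k)
  identity = solve-∀

theorem1p11 : (t s : ℕ) → 2 ≤ t → 2 ≤ s →
    (C : Colouring (2 * s * t * (s + t))) →
    MonoHK C true t ⊎ MonoHK C false s
theorem1p11 t@(suc k) s@(suc l) _ _ C = monochromaticHK C k l
  (square+≤ l t)
  (subst (s * s + s ≤_) (N-sym t s) (square+≤ k s))
  (core-bound k l)
  where
  N-sym : ∀ t s → 2 * t * s * (t + s) ≡ 2 * s * t * (s + t)
  N-sym = solve-∀
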